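{- Consider equations $s = t$ where $s,t$ are terms built from variables, the constant $0$, and a binary operation symbol $\ast$. The length of an equation is the total number of symbol occurrences in $s$ and $t$ (variables, constants, and occurrences of $\ast$; the equality sign is not counted). There is no equation $E$ of length at most $12$ such that, for every algebra $(X,\ast,0)$ of type $(2,0)$, $X$ satisfies $E$ together with the quasi-identity (A3) "for all $x,y$: if $x\ast y=0$ and $y\ast x=0$ then $x=y$" if and only if $X$ is a BCH-algebra.
   Context: A BCH-algebra is an algebra $(X,\ast,0)$ with a binary operation and a constant satisfying, for all $x,y,z\in X$: (B1) $x\ast x=0$; (B2) $x\ast y=0$ and $y\ast x=0$ imply $x=y$; (B3) $(x\ast y)\ast z=(x\ast z)\ast y$. (For comparison, the equation $((x\ast y)\ast z)\ast((x\ast(z\ast 0))\ast y)=0$ has length 14.) -}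

module Defs where

open import Data.Nat using (ℕ; suc; _+_)
open import Data.Product using (_×_)
open import Relation.Binary.PropositionalEquality using (_≡_)

data Term : Set where
  var  : ℕ → Term
  cst0 : Term
  _∗_  : Term → Term → Term

record Equation : Set where
  constructor _≐_
  field
    lhs : Term
    rhs : Term

size : Term → ℕ
size (var _) = 1
size cst0    = 1
size (s ∗ t) = suc (size s + size t)

eqLength : Equation → ℕ
eqLength (s ≐ t) = size s + size t

eval : {X : Set} → (X → X → X) → X → (ℕ → X) → Term → X
eval op z ρ (var n) = ρ n
eval op z ρ cst0    = z
eval op z ρ (s ∗ t) = op (eval op z ρ s) (eval op z ρ t)

Satisfies : {X : Set} → (X → X → X) → X → Equation → Set
Satisfies {X} op z (s ≐ t) = (ρ : ℕ → X) → eval op z ρ s ≡ eval op z ρ t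

A3 : {X : Set} → (X → X → X) → X → Set
A3 {X} op z = (x y : X) → op x y ≡ z → op y x ≡ z → x ≡ y

IsBCH : {X : Set} → (X → X → X) → X → Set
IsBCH {X} op z =
  ((x : X) → op x x ≡ z)
  × A3 op z
  × ((x y w : X) → op (op x y) w ≡ op (op x w) y)

{-# OPTIONS --safe #-}
-- An equation whose sides are both products holds in the two-element algebra with
-- x ∗ y = 1 ≠ 0, which satisfies (A3) vacuously but not x ∗ x = 0. Otherwise one side is a
-- single symbol and the other has at most 11 symbols, and once its variables are renamed in
-- order of first appearance the equation is one of finitely many (about 190 000). A
-- computation over all assignments shows that each of them either fails in one of two
-- 3-element BCH-algebras, so the BCH axioms do not imply it, or holds in one of four
-- 3-element algebras satisfying (A3) but not BCH, so with (A3) it does not imply them.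
-- These six algebras were found by a computer search.

module Submission where

open import Defs
open import Data.Nat using (_≤_)
open import Data.Product using (Σ; _×_)
open import Function.Bundles using (_⇔_)
open import Relation.Nullary using (¬_)

open import Algebra.Core using (Op₂)
open import Data.Bool using (Bool; true; false; T; _∨_)
open import Data.Bool.ListAction using (all; any)
open import Data.Bool.Properties using (T?; T-∨)
open import Data.Fin using (Fin; toℕ; _≟_)
open import Data.Fin.Patterns using (0F; 1F; 2F)
import Data.Fin.Properties as Fin
open import Data.List using (List; []; _∷_; _++_; _∷ʳ_; [_]; length; map; concatMap; upTo)
import Data.List.Properties as List
open import Data.List.Membership.Propositional using (_∈_)
open import Data.List.Membership.Propositional.Properties
  using (∈-++⁺ˡ; ∈-++⁺ʳ; ∈-map⁺; ∈-concatMap⁺; ∈-upTo⁺)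
open import Data.List.Relation.Unary.All as All using (All)
open import Data.List.Relation.Unary.All.Properties using (all⁺)
import Data.List.Relation.Unary.Any as Any
open import Data.List.Relation.Unary.Any using (here; there)
open import Data.List.Relation.Unary.Any.Properties using (any⁻)
open import Data.Nat using (ℕ; zero; suc; _+_; _∸_; _<_; _<?_; z≤n; s≤s; s≤s⁻¹)
import Data.Nat as ℕ
import Data.Nat.Properties as ℕ
open import Data.Product using (∃; _,_; proj₁; map₁)
open import Data.Product.Function.NonDependent.Propositional using (_×-⇔_)
open import Data.Sum using (inj₁; inj₂)
open import Data.Unit using (⊤)
open import Data.Vec using (Vec; []; _∷_; lookup; tabulate)
open import Function using (_∘_)
open import Function.Bundles using (Equivalence; mk⇔)
import Function.Properties.Equivalence as ⇔
open import Relation.Binary.PropositionalEquality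
  using (_≡_; refl; sym; trans; cong; cong₂; subst; subst₂; module ≡-Reasoning)
open import Relation.Nullary using (Dec; yes; no; ¬?; contradiction)
open import Relation.Nullary.Decidable
  using (map′; _×-dec_; _→-dec_; isYes; isNo; toWitness; toWitnessFalse; from-yes)

private
  variable
    A X : Set
    op : Op₂ X
    z : X
    E E′ : Equation
    a b c d s t : Term
    i k k′ k₁ k₂ m n : ℕ
    σ σ′ L : List ℕ

AxiomatizesBCH : Equation → Set₁
AxiomatizesBCH E =
  (X : Set) (op : X → X → X) (z : X) → (Satisfies op z E × A3 op z) ⇔ IsBCH op z

fails-in-BCH⇒¬axiomatizes : IsBCH op z → ¬ Satisfies op z E → ¬ AxiomatizesBCH E
fails-in-BCH⇒¬axiomatizes {op = op} {z = z} bch ¬sat ax =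
  ¬sat (proj₁ (Equivalence.from (ax _ op z) bch))

holds-in-non-BCH⇒¬axiomatizes : A3 op z → ¬ IsBCH op z → Satisfies op z E → ¬ AxiomatizesBCH E
holds-in-non-BCH⇒¬axiomatizes {op = op} {z = z} a3 ¬bch sat ax =
  ¬bch (Equivalence.to (ax _ op z) (sat , a3))

compound-equation-¬axiomatizes : ∀ a b c d → ¬ AxiomatizesBCH ((a ∗ b) ≐ (c ∗ d))
compound-equation-¬axiomatizes a b c d =
  holds-in-non-BCH⇒¬axiomatizes {op = λ _ _ → true} {z = false} {E = (a ∗ b) ≐ (c ∗ d)}
    (λ _ _ ()) (λ (x∗x≡0 , _) → contradiction (x∗x≡0 true) λ ()) (λ _ → refl)

record Equivalent (E E′ : Equation) : Set₁ where
  field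
    satisfies⇔ : (op : Op₂ X) (z : X) → Satisfies op z E ⇔ Satisfies op z E′

axiomatizesBCH-resp : Equivalent E E′ → AxiomatizesBCH E → AxiomatizesBCH E′
axiomatizesBCH-resp E≈E′ ax X op z =
  ⇔.trans (⇔.sym (Equivalent.satisfies⇔ E≈E′ op z) ×-⇔ ⇔.refl) (ax X op z)

≐-swap : ∀ s t → Equivalent (s ≐ t) (t ≐ s)
≐-swap s t = record
  { satisfies⇔ = λ op z → mk⇔ (λ sat ρ → sym (sat ρ)) (λ sat ρ → sym (sat ρ)) }

rename : (ℕ → ℕ) → Term → Term
rename f (var i) = var (f i)
rename f cst0    = cst0
rename f (a ∗ b) = rename f a ∗ rename f b

renameₑ : (ℕ → ℕ) → Equation → Equation
renameₑ f (s ≐ t) = rename f s ≐ rename f t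

eval-rename : ∀ (op : Op₂ X) z ρ f t → eval op z ρ (rename f t) ≡ eval op z (ρ ∘ f) t
eval-rename op z ρ f (var i) = refl
eval-rename op z ρ f cst0    = refl
eval-rename op z ρ f (a ∗ b) = cong₂ op (eval-rename op z ρ f a) (eval-rename op z ρ f b)

satisfies-renameₑ : ∀ f E → Satisfies op z E → Satisfies op z (renameₑ f E)
satisfies-renameₑ {op = op} {z = z} f (s ≐ t) sat ρ = begin
  eval op z ρ (rename f s)  ≡⟨ eval-rename op z ρ f s ⟩
  eval op z (ρ ∘ f) s       ≡⟨ sat (ρ ∘ f) ⟩
  eval op z (ρ ∘ f) t       ≡⟨ eval-rename op z ρ f t ⟨
  eval op z ρ (rename f t)  ∎
  where open ≡-Reasoning

mutual-renamings⇒equivalent : ∀ f g → renameₑ f E ≡ E′ → renameₑ g E′ ≡ E → Equivalent E E′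
mutual-renamings⇒equivalent {E} {E′} f g fE≡E′ gE′≡E = record
  { satisfies⇔ = λ op z → mk⇔
      (λ sat → subst (Satisfies op z) fE≡E′ (satisfies-renameₑ f E sat))
      (λ sat → subst (Satisfies op z) gE′≡E (satisfies-renameₑ g E′ sat)) }

-- Canonical forms of equations

-- Canonical k t k′: reading t from left to right, each variable is either one of the k
-- already in use or the next fresh one; k′ are in use afterwards.
data Canonical : ℕ → Term → ℕ → Set where
  cst0 : Canonical k cst0 k
  old  : i < k → Canonical k (var i) k
  new  : Canonical k (var k) (suc k)
  _∗_  : Canonical k a k₁ → Canonical k₁ b k₂ → Canonical k (a ∗ b) k₂

Below : ℕ → Term → Set
Below k (var i) = i < k
Below k cst0    = ⊤
Below k (a ∗ b) = Below k a × Below k b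

below-mono : k ≤ k′ → Below k t → Below k′ t
below-mono {t = var i} k≤k′ i<k       = ℕ.<-≤-trans i<k k≤k′
below-mono {t = cst0}  k≤k′ _         = _
below-mono {t = a ∗ b} k≤k′ (ba , bb) = below-mono k≤k′ ba , below-mono k≤k′ bb

canonical-mono : Canonical k t k′ → k ≤ k′
canonical-mono cst0    = ℕ.≤-refl
canonical-mono (old _) = ℕ.≤-refl
canonical-mono new     = ℕ.n≤1+n _
canonical-mono (a ∗ b) = ℕ.≤-trans (canonical-mono a) (canonical-mono b)

canonical⇒below : Canonical k t k′ → Below k′ t
canonical⇒below cst0      = _
canonical⇒below (old i<k) = i<k
canonical⇒below new       = ℕ.≤-refl
canonical⇒below (a ∗ b)   = below-mono (canonical-mono b) (canonical⇒below a) , canonical⇒below b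

indexOf : List ℕ → ℕ → ℕ
indexOf []      n = 0
indexOf (m ∷ σ) n with m ℕ.≟ n
... | yes _ = 0
... | no  _ = suc (indexOf σ n)

nth : List ℕ → ℕ → ℕ
nth []      _       = 0
nth (m ∷ σ) zero    = m
nth (m ∷ σ) (suc i) = nth σ i

indexOf-≤ : ∀ σ n → indexOf σ n ≤ length σ
indexOf-≤ []      n = z≤n
indexOf-≤ (m ∷ σ) n with m ℕ.≟ n
... | yes _ = z≤n
... | no  _ = s≤s (indexOf-≤ σ n)

indexOf-++ˡ : ∀ σ {τ n} → indexOf σ n < length σ → indexOf (σ ++ τ) n ≡ indexOf σ n
indexOf-++ˡ (m ∷ σ) {n = n} found with m ℕ.≟ n
... | yes _ = refl
... | no  _ = cong suc (indexOf-++ˡ σ (s≤s⁻¹ found))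

indexOf-++-∷ : ∀ σ {τ n} → indexOf σ n ≡ length σ → indexOf (σ ++ n ∷ τ) n ≡ length σ
indexOf-++-∷ []      {n = n} _ with n ℕ.≟ n
... | yes _   = refl
... | no  n≢n = contradiction refl n≢n
indexOf-++-∷ (m ∷ σ) {n = n} absent with m ℕ.≟ n
... | yes _ = contradiction absent λ ()
... | no  _ = cong suc (indexOf-++-∷ σ (ℕ.suc-injective absent))

nth-indexOf : ∀ σ {n} → indexOf σ n < length σ → nth σ (indexOf σ n) ≡ n
nth-indexOf (m ∷ σ) {n} found with m ℕ.≟ n
... | yes m≡n = m≡n
... | no  _   = nth-indexOf σ (s≤s⁻¹ found)

nth-++ˡ : ∀ σ {τ i} → i < length σ → nth (σ ++ τ) i ≡ nth σ i
nth-++ˡ (m ∷ σ) {i = zero}  _         = refl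
nth-++ˡ (m ∷ σ) {i = suc i} (s≤s i<k) = nth-++ˡ σ i<k

nth-++-∷ : ∀ σ {n τ} → nth (σ ++ n ∷ τ) (length σ) ≡ n
nth-++-∷ []      = refl
nth-++-∷ (m ∷ σ) = nth-++-∷ σ

absent⇒indexOf≡length : ∀ σ {n} → ¬ indexOf σ n < length σ → indexOf σ n ≡ length σ
absent⇒indexOf≡length σ {n} = ℕ.≤∧≮⇒≡ (indexOf-≤ σ n)

-- canon σ t renames each variable of t to its position in seen σ t, which is σ followed by
-- the variables of t missing from σ, in order of first appearance.
seen : List ℕ → Term → List ℕ
seen σ (var n) with indexOf σ n <? length σ
... | yes _ = σ
... | no  _ = σ ∷ʳ n
seen σ cst0    = σ
seen σ (a ∗ b) = seen (seen σ a) b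

canon : List ℕ → Term → Term
canon σ (var n) = var (indexOf σ n)
canon σ cst0    = cst0
canon σ (a ∗ b) = canon σ a ∗ canon (seen σ a) b

_≼_ : List ℕ → List ℕ → Set
σ ≼ L = ∃ λ τ → L ≡ σ ++ τ

≼-refl : σ ≼ σ
≼-refl {σ} = [] , sym (List.++-identityʳ σ)

≼-trans : σ ≼ σ′ → σ′ ≼ L → σ ≼ L
≼-trans {σ} (τ , refl) (τ′ , refl) = τ ++ τ′ , List.++-assoc σ τ τ′

≼-seen : ∀ σ t → σ ≼ seen σ t
≼-seen σ (var n) with indexOf σ n <? length σ
... | yes _ = ≼-refl
... | no  _ = [ n ] , refl
≼-seen σ cst0    = ≼-refl
≼-seen σ (a ∗ b) = ≼-trans (≼-seen σ a) (≼-seen (seen σ a) b)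

canon-canonical : ∀ σ t → Canonical (length σ) (canon σ t) (length (seen σ t))
canon-canonical σ (var n) with indexOf σ n <? length σ
... | yes found  = old found
... | no  absent = subst₂ (Canonical (length σ))
  (cong var (sym (absent⇒indexOf≡length σ absent)))
  (sym (trans (List.length-++ σ) (ℕ.+-comm (length σ) 1)))
  new
canon-canonical σ cst0    = cst0
canon-canonical σ (a ∗ b) = canon-canonical σ a ∗ canon-canonical (seen σ a) b

canon-forward : ∀ σ t → seen σ t ≼ L → rename (indexOf L) t ≡ canon σ t
canon-forward σ (var n) seen≼L with indexOf σ n <? length σ | seen≼L
... | yes found  | τ , refl = cong var (indexOf-++ˡ σ found)
... | no  absent | τ , refl = cong var (begin
  indexOf ((σ ∷ʳ n) ++ τ) n  ≡⟨ cong (λ L → indexOf L n) (List.∷ʳ-++ σ n τ) ⟩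
  indexOf (σ ++ n ∷ τ) n     ≡⟨ indexOf-++-∷ σ n-new ⟩
  length σ                   ≡⟨ n-new ⟨
  indexOf σ n                ∎)
  where
  open ≡-Reasoning
  n-new = absent⇒indexOf≡length σ absent
canon-forward σ cst0    _      = refl
canon-forward σ (a ∗ b) seen≼L = cong₂ _∗_
  (canon-forward σ a (≼-trans (≼-seen (seen σ a) b) seen≼L))
  (canon-forward (seen σ a) b seen≼L)

canon-backward : ∀ σ t → seen σ t ≼ L → rename (nth L) (canon σ t) ≡ t
canon-backward σ (var n) seen≼L with indexOf σ n <? length σ | seen≼L
... | yes found  | τ , refl = cong var (trans (nth-++ˡ σ found) (nth-indexOf σ found))
... | no  absent | τ , refl = cong var (begin
  nth ((σ ∷ʳ n) ++ τ) (indexOf σ n)  ≡⟨ cong₂ nth (List.∷ʳ-++ σ n τ) n-new ⟩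
  nth (σ ++ n ∷ τ) (length σ)        ≡⟨ nth-++-∷ σ ⟩
  n                                  ∎)
  where
  open ≡-Reasoning
  n-new = absent⇒indexOf≡length σ absent
canon-backward σ cst0    _      = refl
canon-backward σ (a ∗ b) seen≼L = cong₂ _∗_
  (canon-backward σ a (≼-trans (≼-seen (seen σ a) b) seen≼L))
  (canon-backward (seen σ a) b seen≼L)

size-canon : ∀ σ t → size (canon σ t) ≡ size t
size-canon σ (var n) = refl
size-canon σ cst0    = refl
size-canon σ (a ∗ b) = cong₂ (λ m n → suc (m + n)) (size-canon σ a) (size-canon (seen σ a) b)

canonₑ-equivalent : ∀ s t → Equivalent (s ≐ t) (canon [] s ≐ canon (seen [] s) t)
canonₑ-equivalent s t = mutual-renamings⇒equivalent (indexOf σ₂) (nth σ₂)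
  (cong₂ _≐_ (canon-forward [] s (≼-seen σ₁ t)) (canon-forward σ₁ t ≼-refl))
  (cong₂ _≐_ (canon-backward [] s (≼-seen σ₁ t)) (canon-backward σ₁ t ≼-refl))
  where
  σ₁ = seen [] s
  σ₂ = seen σ₁ t

leaves : ℕ → List (Term × ℕ)
leaves k = (cst0 , k) ∷ (var k , suc k) ∷ map (λ i → var i , k) (upTo k)

mutual
  -- Canonical terms of size at most b with their final variable count; the fuel f ≥ b only
  -- makes the recursion structural.
  canonicals : (f b k : ℕ) → List (Term × ℕ)
  canonicals zero    _       _ = []
  canonicals (suc f) zero    _ = []
  canonicals (suc f) (suc b) k = leaves k ++ concatMap (products f b) (canonicals f b k)

  products : (f b : ℕ) → Term × ℕ → List (Term × ℕ)
  products f b (a , k₁) = map (map₁ (a ∗_)) (canonicals f (b ∸ size a) k₁)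

∈-canonicals : ∀ {f b} → Canonical k t k′ → size t ≤ b → size t ≤ f → (t , k′) ∈ canonicals f b k
∈-canonicals cst0      (s≤s _) (s≤s _) = here refl
∈-canonicals new       (s≤s _) (s≤s _) = there (here refl)
∈-canonicals {k = k} (old i<k) (s≤s _) (s≤s _) =
  there (there (∈-++⁺ˡ (∈-map⁺ (λ i → var i , k) (∈-upTo⁺ i<k))))
∈-canonicals {k = k} {t = a ∗ c} {f = suc f} {b = suc b} (ca ∗ cc) (s≤s a+c≤b) (s≤s a+c≤f) =
  ∈-++⁺ʳ (leaves k) (∈-concatMap⁺ (products f b)
    (Any.map (λ { refl → ∈-map⁺ (map₁ (a ∗_)) c∈ }) a∈))
  where
  a∈ = ∈-canonicals ca (ℕ.m+n≤o⇒m≤o (size a) a+c≤b) (ℕ.m+n≤o⇒m≤o (size a) a+c≤f)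
  c∈ = ∈-canonicals cc (ℕ.m+n≤o⇒m≤o∸n (size c) (subst (_≤ b) (ℕ.+-comm (size a) (size c)) a+c≤b))
                        (ℕ.m+n≤o⇒n≤o (size a) a+c≤f)

-- Equations in finite algebras

Holds : Op₂ X → X → (ℕ → X) → Equation → Set
Holds op z ρ (s ≐ t) = eval op z ρ s ≡ eval op z ρ t

assignment : A → Vec A k → ℕ → A
assignment d []      _       = d
assignment d (x ∷ v) zero    = x
assignment d (x ∷ v) (suc i) = assignment d v i

assignment-tabulate : ∀ (d : A) ρ → i < k → assignment d (tabulate {n = k} (ρ ∘ toℕ)) i ≡ ρ i
assignment-tabulate {i = zero}  d ρ (s≤s _)   = refl
assignment-tabulate {i = suc i} d ρ (s≤s i<k) = assignment-tabulate d (ρ ∘ suc) i<k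

HoldsOnVectors : Op₂ X → X → ℕ → Equation → Set
HoldsOnVectors {X} op z k E = (v : Vec X k) → Holds op z (assignment z v) E

eval-cong-below : ∀ {ρ ρ′ : ℕ → X} → (∀ {i} → i < k → ρ i ≡ ρ′ i) → Below k t →
                  eval op z ρ t ≡ eval op z ρ′ t
eval-cong-below {t = var i}          ρ≗ρ′ i<k       = ρ≗ρ′ i<k
eval-cong-below {t = cst0}           ρ≗ρ′ _         = refl
eval-cong-below {t = a ∗ b} {op = op} ρ≗ρ′ (ba , bb) =
  cong₂ op (eval-cong-below ρ≗ρ′ ba) (eval-cong-below ρ≗ρ′ bb)

holds-on-vectors⇒satisfies : Below k s → Below k t → HoldsOnVectors op z k (s ≐ t) →
                             Satisfies op z (s ≐ t)
holds-on-vectors⇒satisfies {k} {s} {t} {op = op} {z = z} bs bt holds ρ = begin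
  eval op z ρ s   ≡⟨ eval-cong-below agree bs ⟨
  eval op z ρ′ s  ≡⟨ holds v ⟩
  eval op z ρ′ t  ≡⟨ eval-cong-below agree bt ⟩
  eval op z ρ t   ∎
  where
  open ≡-Reasoning
  v  = tabulate {n = k} (ρ ∘ toℕ)
  ρ′ = assignment z v
  agree : ∀ {i} → i < k → ρ′ i ≡ ρ i
  agree = assignment-tabulate z ρ

∀-vec? : ∀ k {P : Vec (Fin m) k → Set} → (∀ v → Dec (P v)) → Dec (∀ v → P v)
∀-vec? zero    P? = map′ (λ p → λ { [] → p }) (λ ∀P → ∀P []) (P? [])
∀-vec? (suc k) P? = map′ (λ ∀P → λ { (x ∷ v) → ∀P x v }) (λ ∀P x v → ∀P (x ∷ v))
  (Fin.all? λ x → ∀-vec? k (P? ∘ (x ∷_)))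

holdsOnVectors? : ∀ (op : Op₂ (Fin m)) z k E → Dec (HoldsOnVectors op z k E)
holdsOnVectors? op z k (s ≐ t) =
  ∀-vec? k λ v → eval op z (assignment z v) s ≟ eval op z (assignment z v) t

a3? : ∀ (op : Op₂ (Fin m)) z → Dec (A3 op z)
a3? op z = Fin.all? λ x → Fin.all? λ y → (op x y ≟ z) →-dec (op y x ≟ z) →-dec (x ≟ y)

isBCH? : ∀ (op : Op₂ (Fin m)) z → Dec (IsBCH op z)
isBCH? op z = (Fin.all? λ x → op x x ≟ z)
  ×-dec a3? op z
  ×-dec (Fin.all? λ x → Fin.all? λ y → Fin.all? λ w → op (op x y) w ≟ op (op x w) y)

cayley : Vec (Vec (Fin n) n) n → Op₂ (Fin n)
cayley rows x y = lookup (lookup rows x) y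

-- subtraction in ℤ/3ℤ
subtraction₃ : Op₂ (Fin 3)
subtraction₃ = cayley
  ( (0F ∷ 2F ∷ 1F ∷ [])
  ∷ (1F ∷ 0F ∷ 2F ∷ [])
  ∷ (2F ∷ 1F ∷ 0F ∷ [])
  ∷ [])

-- truncated subtraction on {0, 1, 2}
monus₃ : Op₂ (Fin 3)
monus₃ = cayley
  ( (0F ∷ 0F ∷ 0F ∷ [])
  ∷ (1F ∷ 0F ∷ 0F ∷ [])
  ∷ (2F ∷ 1F ∷ 0F ∷ [])
  ∷ [])

leftProjection₃ : Op₂ (Fin 3)
leftProjection₃ x _ = x

M₁ M₂ M₃ : Op₂ (Fin 3)
M₁ = cayley
  ( (0F ∷ 0F ∷ 0F ∷ [])
  ∷ (1F ∷ 0F ∷ 1F ∷ [])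
  ∷ (2F ∷ 1F ∷ 0F ∷ [])
  ∷ [])
M₂ = cayley
  ( (0F ∷ 0F ∷ 0F ∷ [])
  ∷ (1F ∷ 0F ∷ 0F ∷ [])
  ∷ (1F ∷ 1F ∷ 1F ∷ [])
  ∷ [])
M₃ = cayley
  ( (0F ∷ 0F ∷ 0F ∷ [])
  ∷ (1F ∷ 0F ∷ 1F ∷ [])
  ∷ (1F ∷ 0F ∷ 1F ∷ [])
  ∷ [])

bchAlgebras : List (Op₂ (Fin 3))
bchAlgebras = subtraction₃ ∷ monus₃ ∷ []

-- M₁ violates only (B3); the other three violate x ∗ x = 0.
nonBCHAlgebras : List (Op₂ (Fin 3))
nonBCHAlgebras = leftProjection₃ ∷ M₁ ∷ M₂ ∷ M₃ ∷ []

bchAlgebras-areBCH : All (λ op → IsBCH op 0F) bchAlgebras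
bchAlgebras-areBCH = from-yes (All.all? (λ op → isBCH? op 0F) bchAlgebras)

nonBCHAlgebras-areA3-nonBCH : All (λ op → A3 op 0F × ¬ IsBCH op 0F) nonBCHAlgebras
nonBCHAlgebras-areA3-nonBCH =
  from-yes (All.all? (λ op → a3? op 0F ×-dec ¬? (isBCH? op 0F)) nonBCHAlgebras)

failsIn? holdsIn? : ℕ → Equation → Op₂ (Fin 3) → Bool
failsIn? k E op = isNo (holdsOnVectors? op 0F k E)
holdsIn? k E op = isYes (holdsOnVectors? op 0F k E)

refutable? : ℕ → Equation → Bool
refutable? k E = any (failsIn? k E) bchAlgebras ∨ any (holdsIn? k E) nonBCHAlgebras

refutable⇒¬axiomatizes : Below k s → Below k t → T (refutable? k (s ≐ t)) →
                         ¬ AxiomatizesBCH (s ≐ t)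
refutable⇒¬axiomatizes {k} {s} {t} bs bt ok with Equivalence.to T-∨ ok
... | inj₁ fails =
  let bch , ¬holds = All.lookupAny bchAlgebras-areBCH
                       (any⁻ (failsIn? k (s ≐ t)) bchAlgebras fails)
  in fails-in-BCH⇒¬axiomatizes {E = s ≐ t} bch (λ sat → toWitnessFalse ¬holds (λ v → sat _))
... | inj₂ holds =
  let (a3 , ¬bch) , holds′ = All.lookupAny nonBCHAlgebras-areA3-nonBCH
                               (any⁻ (holdsIn? k (s ≐ t)) nonBCHAlgebras holds)
  in holds-in-non-BCH⇒¬axiomatizes {E = s ≐ t} a3 ¬bch
       (holds-on-vectors⇒satisfies bs bt (toWitness holds′))

rhsRefutable? : Term → Term × ℕ → Bool
rhsRefutable? s (t , k) = refutable? k (s ≐ t)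

leafRhsRefutable? : Term × ℕ → Bool
leafRhsRefutable? (s , k₁) = all (rhsRefutable? s) (canonicals 1 1 k₁)

canonical-lhs-checked : All (T ∘ leafRhsRefutable?) (canonicals 11 11 0)
canonical-lhs-checked = from-yes (All.all? (T? ∘ leafRhsRefutable?) (canonicals 11 11 0))

canonical-¬axiomatizes : Canonical 0 s k₁ → Canonical k₁ t k₂ → size s ≤ 11 → size t ≤ 1 →
                         ¬ AxiomatizesBCH (s ≐ t)
canonical-¬axiomatizes {s} {k₁} cs ct s≤11 t≤1 = refutable⇒¬axiomatizes
  (below-mono (canonical-mono ct) (canonical⇒below cs)) (canonical⇒below ct)
  (All.lookup (all⁺ (rhsRefutable? s) (canonicals 1 1 k₁) (All.lookup canonical-lhs-checked s∈)) t∈)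
  where
  s∈ = ∈-canonicals cs s≤11 s≤11
  t∈ = ∈-canonicals ct t≤1 t≤1

short-equation-¬axiomatizes : ∀ s t → size s ≤ 11 → size t ≤ 1 → ¬ AxiomatizesBCH (s ≐ t)
short-equation-¬axiomatizes s t s≤11 t≤1 ax = canonical-¬axiomatizes
  (canon-canonical [] s) (canon-canonical (seen [] s) t)
  (subst (_≤ 11) (sym (size-canon [] s)) s≤11)
  (subst (_≤ 1) (sym (size-canon (seen [] s) t)) t≤1)
  (axiomatizesBCH-resp (canonₑ-equivalent s t) ax)

length≤12-¬axiomatizes : ∀ E → eqLength E ≤ 12 → ¬ AxiomatizesBCH E
length≤12-¬axiomatizes ((a ∗ b) ≐ (c ∗ d)) _ =
  compound-equation-¬axiomatizes a b c d
length≤12-¬axiomatizes (s ≐ var n) len =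
  short-equation-¬axiomatizes s (var n) (ℕ.+-cancelʳ-≤ 1 (size s) 11 len) ℕ.≤-refl
length≤12-¬axiomatizes (s ≐ cst0) len =
  short-equation-¬axiomatizes s cst0 (ℕ.+-cancelʳ-≤ 1 (size s) 11 len) ℕ.≤-refl
length≤12-¬axiomatizes (var n ≐ (c ∗ d)) len ax =
  short-equation-¬axiomatizes (c ∗ d) (var n) (s≤s⁻¹ len) ℕ.≤-refl
    (axiomatizesBCH-resp (≐-swap (var n) (c ∗ d)) ax)
length≤12-¬axiomatizes (cst0 ≐ (c ∗ d)) len ax =
  short-equation-¬axiomatizes (c ∗ d) cst0 (s≤s⁻¹ len) ℕ.≤-refl
    (axiomatizesBCH-resp (≐-swap cst0 (c ∗ d)) ax)

mainTheorem2 : ¬ (Σ Equation λ E → (eqLength E ≤ 12)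
                 × ((X : Set) (op : X → X → X) (z : X) →
                      (Satisfies op z E × A3 op z) ⇔ IsBCH op z))
mainTheorem2 (E , len , ax) = length≤12-¬axiomatizes E len ax
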